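{- Consider black/white Mastermind with $n$ positions, a color set $C$ with $|C|=k$, and secret code $z\in C^n$; let $C^*=\{z_i:i\in[n]\}$ and $\mathrm{col}(X)=|C^*\cap X|$ for $X\subseteq C$. Then there are sets $X_1,\dots,X_m\subseteq C$ with $m=\lceil k/n\rceil$ and $|X_j|\le n$ for all $j$, such that from the values $\mathrm{col}(X_1),\dots,\mathrm{col}(X_m)$ one can compute both $|C^*|$ and a set $C_0\supseteq C^*$ with $|C_0|\le n|C^*|$. (I.e., with $\lceil k/n\rceil$ color queries Codebreaker learns $|C^*|$ and such a superset $C_0$.)
   Context: A color query is a query revealing $\mathrm{col}(X)$ for a set $X$ of at most $n$ colors (in black/white Mastermind this can be realized by one ordinary query after one initial query). -}

module Defs where

open import Data.Nat using (ℕ; suc; _+_; _∸_; NonZero)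
open import Data.Nat.DivMod using (_/_)
open import Data.Bool using (Bool)
open import Data.Fin using (Fin; _≟_)
open import Data.Fin.Subset using (Subset; _∩_; ∣_∣)
open import Data.Fin.Properties using (any?)
open import Data.Vec using (tabulate)
open import Relation.Nullary using (does)

⌈_/_⌉ : (k n : ℕ) → .{{NonZero n}} → ℕ
⌈ k / n ⌉ = (k + (n ∸ 1)) / n

-- colour set C = Fin k, secret code z ∈ C^n as a function Fin n → Fin k.
-- C* = { z i | i ∈ [n] }
Cstar : {n k : ℕ} → (Fin n → Fin k) → Subset k
Cstar z = tabulate (λ c → does (any? (λ i → z i ≟ c)))

col : {n k : ℕ} → (Fin n → Fin k) → Subset k → ℕ
col z X = ∣ Cstar z ∩ X ∣

-- Cut the k colours into ⌈k/n⌉ consecutive blocks of at most n colours and query each block.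
-- The answers add up to |C*|, and the union of the blocks with a nonzero answer contains C*;
-- every such block contains a colour of C* and has at most n colours, so the union has at
-- most n·|C*| colours. Nothing about the code z is used beyond its colour set C*, so the
-- construction is carried out for an arbitrary set S of colours.
module Submission where

open import Defs
open import Data.Nat using (ℕ; zero; suc; _+_; _*_; _∸_; _≤_; z≤n; NonZero)
open import Data.Nat.Properties
open import Data.Nat.DivMod using (_%_; m≡m%n+[m/n]*n; m%n<n)
open import Data.Bool using (_∧_)
open import Data.Fin using (Fin)
open import Data.Fin.Subset using (Subset; _⊆_; _∩_; ∣_∣; ⊥; ⊤; inside; outside)
open import Data.Fin.Subset.Properties
  using (∣⊥∣≡0; ∣⊤∣≡n; ⊆⊤; ⊥⊆; drop-∷-⊆; ∩-identityʳ; ∩-zeroʳ)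
open import Data.Vec using (Vec; []; _∷_; _++_; map; splitAt; here; there)
open import Data.Vec.Properties using (zipWith-++; map-∘; map-cong)
open import Data.Vec.Relation.Unary.All as All using (All; []; _∷_)
open import Data.Vec.Relation.Unary.All.Properties using (map⁺)
open import Data.Product using (Σ; _×_; _,_; proj₁; proj₂)
open import Relation.Binary.PropositionalEquality
  using (_≡_; refl; sym; trans; cong; cong₂; subst; module ≡-Reasoning)

∣p++q∣≡∣p∣+∣q∣ : ∀ {k₁ k₂} (p : Subset k₁) (q : Subset k₂) → ∣ p ++ q ∣ ≡ ∣ p ∣ + ∣ q ∣
∣p++q∣≡∣p∣+∣q∣ []            q = refl
∣p++q∣≡∣p∣+∣q∣ (inside  ∷ p) q = cong suc (∣p++q∣≡∣p∣+∣q∣ p q)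
∣p++q∣≡∣p∣+∣q∣ (outside ∷ p) q = ∣p++q∣≡∣p∣+∣q∣ p q

∣[p++q]∩[p′++q′]∣ : ∀ {k₁ k₂} (p p′ : Subset k₁) (q q′ : Subset k₂) →
  ∣ (p ++ q) ∩ (p′ ++ q′) ∣ ≡ ∣ p ∩ p′ ∣ + ∣ q ∩ q′ ∣
∣[p++q]∩[p′++q′]∣ p p′ q q′ =
  trans (cong ∣_∣ (zipWith-++ _∧_ p q p′ q′)) (∣p++q∣≡∣p∣+∣q∣ (p ∩ p′) (q ∩ q′))

∣p∣≡0⇒p≡⊥ : ∀ {k} (p : Subset k) → ∣ p ∣ ≡ 0 → p ≡ ⊥
∣p∣≡0⇒p≡⊥ []            _     = refl
∣p∣≡0⇒p≡⊥ (outside ∷ p) ∣p∣≡0 = cong (outside ∷_) (∣p∣≡0⇒p≡⊥ p ∣p∣≡0)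

++-mono-⊆ : ∀ {k₁ k₂} {p p′ : Subset k₁} {q q′ : Subset k₂} →
  p ⊆ p′ → q ⊆ q′ → p ++ q ⊆ p′ ++ q′
++-mono-⊆ {p = []}    {[]}    p⊆p′ q⊆q′ x∈q = q⊆q′ x∈q
++-mono-⊆ {p = _ ∷ _} {_ ∷ _} p⊆p′ q⊆q′ here with p⊆p′ here
... | here = here
++-mono-⊆ {p = _ ∷ _} {_ ∷ _} p⊆p′ q⊆q′ (there x∈p++q) =
  there (++-mono-⊆ (drop-∷-⊆ p⊆p′) q⊆q′ x∈p++q)

answers : ∀ {k m} → Subset k → Vec (Subset k) m → Vec ℕ m
answers S = map (λ X → ∣ S ∩ X ∣)

Reveals : ∀ {k} → ℕ → Subset k → ℕ × Subset k → Set
Reveals b S r = proj₁ r ≡ ∣ S ∣ × S ⊆ proj₂ r × ∣ proj₂ r ∣ ≤ b * ∣ S ∣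

record QueryScheme (b m k : ℕ) : Set where
  field
    queries        : Vec (Subset k) m
    queries-small  : All (λ X → ∣ X ∣ ≤ b) queries
    decode         : Vec ℕ m → ℕ × Subset k
    decode-reveals : (S : Subset k) → Reveals b S (decode (answers S queries))

emptyScheme : ∀ {b} → QueryScheme b 0 0
emptyScheme = record
  { queries        = []
  ; queries-small  = []
  ; decode         = λ _ → 0 , []
  ; decode-reveals = λ { [] → refl , (λ ()) , z≤n }
  }

blockIfHit : ∀ {k} → ℕ → Subset k
blockIfHit zero    = ⊥
blockIfHit (suc _) = ⊤

⊆-blockIfHit : ∀ {k} (S : Subset k) → S ⊆ blockIfHit ∣ S ∣
⊆-blockIfHit S with ∣ S ∣ in ∣S∣≡
... | zero  = subst (_⊆ ⊥) (sym (∣p∣≡0⇒p≡⊥ S ∣S∣≡)) ⊥⊆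
... | suc _ = ⊆⊤

∣blockIfHit∣≤ : ∀ {b k} → k ≤ b → (a : ℕ) → ∣ blockIfHit {k} a ∣ ≤ b * a
∣blockIfHit∣≤ {b} {k} k≤b zero = ≤-trans (≤-reflexive (∣⊥∣≡0 k)) z≤n
∣blockIfHit∣≤ {b} {k} k≤b a@(suc _) = begin
  ∣ ⊤ {k} ∣ ≡⟨ ∣⊤∣≡n k ⟩
  k         ≤⟨ k≤b ⟩
  b         ≤⟨ m≤m*n b a ⟩
  b * a     ∎
  where open ≤-Reasoning

Reveals-++ : ∀ {b k₁ k₂} → k₁ ≤ b → (S₁ : Subset k₁) {S₂ : Subset k₂} {r : ℕ × Subset k₂} →
  Reveals b S₂ r → Reveals b (S₁ ++ S₂) (∣ S₁ ∣ + proj₁ r , blockIfHit ∣ S₁ ∣ ++ proj₂ r)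
Reveals-++ {b} k₁≤b S₁ {S₂} {c , U} (c≡ , S₂⊆U , ∣U∣≤) =
  trans (cong (∣ S₁ ∣ +_) c≡) (sym (∣p++q∣≡∣p∣+∣q∣ S₁ S₂)) ,
  ++-mono-⊆ (⊆-blockIfHit S₁) S₂⊆U ,
  (begin
    ∣ blockIfHit ∣ S₁ ∣ ++ U ∣        ≡⟨ ∣p++q∣≡∣p∣+∣q∣ (blockIfHit ∣ S₁ ∣) U ⟩
    ∣ blockIfHit ∣ S₁ ∣ ∣ + ∣ U ∣     ≤⟨ +-mono-≤ (∣blockIfHit∣≤ k₁≤b ∣ S₁ ∣) ∣U∣≤ ⟩
    b * ∣ S₁ ∣ + b * ∣ S₂ ∣          ≡⟨ *-distribˡ-+ b ∣ S₁ ∣ ∣ S₂ ∣ ⟨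
    b * (∣ S₁ ∣ + ∣ S₂ ∣)            ≡⟨ cong (b *_) (∣p++q∣≡∣p∣+∣q∣ S₁ S₂) ⟨
    b * ∣ S₁ ++ S₂ ∣                 ∎)
  where open ≤-Reasoning

module _ {k₁ k₂ : ℕ} where

  headBlock : Subset (k₁ + k₂)
  headBlock = ⊤ {k₁} ++ ⊥ {k₂}

  shiftQuery : Subset k₂ → Subset (k₁ + k₂)
  shiftQuery X = ⊥ {k₁} ++ X

  answers-headBlock : (S₁ : Subset k₁) (S₂ : Subset k₂) → ∣ (S₁ ++ S₂) ∩ headBlock ∣ ≡ ∣ S₁ ∣
  answers-headBlock S₁ S₂ = begin
    ∣ (S₁ ++ S₂) ∩ headBlock ∣  ≡⟨ ∣[p++q]∩[p′++q′]∣ S₁ ⊤ S₂ ⊥ ⟩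
    ∣ S₁ ∩ ⊤ ∣ + ∣ S₂ ∩ ⊥ ∣      ≡⟨ cong₂ _+_ (cong ∣_∣ (∩-identityʳ S₁)) (cong ∣_∣ (∩-zeroʳ S₂)) ⟩
    ∣ S₁ ∣ + ∣ ⊥ {k₂} ∣          ≡⟨ cong (∣ S₁ ∣ +_) (∣⊥∣≡0 k₂) ⟩
    ∣ S₁ ∣ + 0                  ≡⟨ +-identityʳ ∣ S₁ ∣ ⟩
    ∣ S₁ ∣                      ∎
    where open ≡-Reasoning

  answers-shiftQuery : (S₁ : Subset k₁) (S₂ X : Subset k₂) →
    ∣ (S₁ ++ S₂) ∩ shiftQuery X ∣ ≡ ∣ S₂ ∩ X ∣
  answers-shiftQuery S₁ S₂ X =
    trans (∣[p++q]∩[p′++q′]∣ S₁ ⊥ S₂ X)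
          (cong (_+ ∣ S₂ ∩ X ∣) (trans (cong ∣_∣ (∩-zeroʳ S₁)) (∣⊥∣≡0 k₁)))

  answers-++ : ∀ {m} (S₁ : Subset k₁) (S₂ : Subset k₂) (Xs : Vec (Subset k₂) m) →
    answers (S₁ ++ S₂) (headBlock ∷ map shiftQuery Xs) ≡ ∣ S₁ ∣ ∷ answers S₂ Xs
  answers-++ S₁ S₂ Xs = cong₂ _∷_ (answers-headBlock S₁ S₂)
    (trans (sym (map-∘ _ shiftQuery Xs)) (map-cong (answers-shiftQuery S₁ S₂) Xs))

  ∣headBlock∣ : ∣ headBlock ∣ ≡ k₁
  ∣headBlock∣ = trans (∣p++q∣≡∣p∣+∣q∣ (⊤ {k₁}) (⊥ {k₂}))
    (trans (cong₂ _+_ (∣⊤∣≡n k₁) (∣⊥∣≡0 k₂)) (+-identityʳ k₁))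

  ∣shiftQuery∣ : (X : Subset k₂) → ∣ shiftQuery X ∣ ≡ ∣ X ∣
  ∣shiftQuery∣ X = trans (∣p++q∣≡∣p∣+∣q∣ (⊥ {k₁}) X) (cong (_+ ∣ X ∣) (∣⊥∣≡0 k₁))

  addBlock : ∀ {b m} → k₁ ≤ b → QueryScheme b m k₂ → QueryScheme b (suc m) (k₁ + k₂)
  addBlock {b} {m} k₁≤b scheme = record
    { queries        = headBlock ∷ map shiftQuery queries
    ; queries-small  = subst (_≤ b) (sym ∣headBlock∣) k₁≤b
                     ∷ map⁺ (All.map (λ {X} → subst (_≤ b) (sym (∣shiftQuery∣ X))) queries-small)
    ; decode         = decode′
    ; decode-reveals = reveals
    }
    where
    open QueryScheme scheme

    decode′ : Vec ℕ (suc m) → ℕ × Subset (k₁ + k₂)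
    decode′ (a ∷ as) = a + proj₁ (decode as) , blockIfHit a ++ proj₂ (decode as)

    reveals : (S : Subset (k₁ + k₂)) →
      Reveals b S (decode′ (answers S (headBlock ∷ map shiftQuery queries)))
    reveals S with splitAt k₁ S
    ... | S₁ , S₂ , refl = subst (λ as → Reveals b (S₁ ++ S₂) (decode′ as))
      (sym (answers-++ S₁ S₂ queries)) (Reveals-++ k₁≤b S₁ (decode-reveals S₂))

blockScheme : ∀ {b} m k → k ≤ m * b → QueryScheme b m k
blockScheme         zero    .zero z≤n = emptyScheme
blockScheme {b = b} (suc m) k     k≤b+mb =
  subst (QueryScheme b (suc m)) (m⊓n+n∸m≡n b k)
    (addBlock (m⊓n≤m b k) (blockScheme m (k ∸ b) (m≤n+o⇒m∸n≤o k b k≤b+mb)))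

-- ⌈ k / n ⌉ is (k + (n ∸ 1)) / n, and the remainder of k + (n ∸ 1) is at most n ∸ 1.
k≤⌈k/n⌉*n : ∀ k n .{{_ : NonZero n}} → k ≤ ⌈ k / n ⌉ * n
k≤⌈k/n⌉*n k n@(suc n-1) = +-cancelʳ-≤ n-1 k (⌈ k / n ⌉ * n) (begin
  k + n-1                           ≡⟨ m≡m%n+[m/n]*n (k + n-1) n ⟩
  (k + n-1) % n + ⌈ k / n ⌉ * n     ≤⟨ +-monoˡ-≤ (⌈ k / n ⌉ * n) (m<1+n⇒m≤n (m%n<n (k + n-1) n)) ⟩
  n-1 + ⌈ k / n ⌉ * n               ≡⟨ +-comm n-1 (⌈ k / n ⌉ * n) ⟩
  ⌈ k / n ⌉ * n + n-1               ∎)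
  where open ≤-Reasoning

lemma8 : (n k : ℕ) .{{_ : NonZero n}} →
    Σ (Vec (Subset k) ⌈ k / n ⌉) λ Xs →
      All (λ X → ∣ X ∣ ≤ n) Xs ×
      Σ (Vec ℕ ⌈ k / n ⌉ → ℕ × Subset k) λ decode →
        (z : Fin n → Fin k) →
          proj₁ (decode (map (col z) Xs)) ≡ ∣ Cstar z ∣ ×
          Cstar z ⊆ proj₂ (decode (map (col z) Xs)) ×
          ∣ proj₂ (decode (map (col z) Xs)) ∣ ≤ n * ∣ Cstar z ∣
lemma8 n k = queries , queries-small , decode , λ z → decode-reveals (Cstar z)
  where open QueryScheme (blockScheme {b = n} ⌈ k / n ⌉ k (k≤⌈k/n⌉*n k n))
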